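{- Let $T$ be a tree of order $n$ and let $d_i$ denote the number of dominating sets of $T$ of size $i$. Then $$d_{\gamma(T)}\le d_{\gamma(T)+1}\le\cdots\le d_{\left\lfloor\frac{n+2\gamma(T)+1}{3}\right\rfloor}.$$
   Context: A dominating set of a graph $G=(V,E)$ is a set $S\subseteq V$ such that every vertex is in $S$ or adjacent to a vertex of $S$; $\gamma(G)$ is the minimum size of a dominating set. -}

module Defs where

open import Data.Nat using (ℕ; zero; suc; _+_; _*_; _≤_; _<_)
open import Data.Bool using (Bool; true; false)
open import Data.Fin using (Fin)
open import Data.Fin.Subset using (Subset; _∈_; ∣_∣)
open import Data.Fin.Subset.Properties using (_∈?_)
open import Data.Fin.Properties using (any?; all?)
open import Data.Vec using (Vec; []; _∷_)
open import Data.List using (List; []; _∷_; map; _++_; length; filter)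
open import Data.List.Relation.Unary.AllPairs using (AllPairs)
open import Data.Product using (Σ; ∃; _×_; _,_)
open import Data.Sum using (_⊎_)
open import Data.Unit using (⊤)
open import Relation.Nullary using (¬_; Dec)
open import Relation.Nullary.Decidable using (_⊎-dec_; _×-dec_)
open import Relation.Binary.PropositionalEquality using (_≡_; _≢_)
open import Data.Bool.Properties using () renaming (_≟_ to _≟B_)

record Graph (n : ℕ) : Set where
  field
    adj   : Fin n → Fin n → Bool
    sym   : ∀ u v → adj u v ≡ adj v u
    irrefl : ∀ v → adj v v ≡ false
open Graph public

Adj : ∀ {n} → Graph n → Fin n → Fin n → Set
Adj G u v = adj G u v ≡ true

data Walk {n} (G : Graph n) : Fin n → Fin n → Set where
  here : ∀ v → Walk G v v
  step : ∀ {u v w} → Adj G u v → Walk G v w → Walk G u w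

Connected : ∀ {n} → Graph n → Set
Connected G = ∀ u v → Walk G u v

ChainFrom : ∀ {n} → Graph n → Fin n → List (Fin n) → Set
ChainFrom G x [] = ⊤
ChainFrom G x (y ∷ ys) = Adj G x y × ChainFrom G y ys

lastOf : ∀ {n} → Fin n → List (Fin n) → Fin n
lastOf x [] = x
lastOf x (y ∷ ys) = lastOf y ys

HasCycle : ∀ {n} → Graph n → Set
HasCycle {n} G =
  Σ (Fin n) λ x → Σ (List (Fin n)) λ ys →
    (2 ≤ length ys) × AllPairs _≢_ (x ∷ ys) × ChainFrom G x ys × Adj G (lastOf x ys) x

IsTree : ∀ {n} → Graph n → Set
IsTree {n} G = (1 ≤ n) × Connected G × ¬ HasCycle G

Dominating : ∀ {n} → Graph n → Subset n → Set
Dominating {n} G S = ∀ v → (v ∈ S) ⊎ (∃ λ u → (u ∈ S) × Adj G u v)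

dominating? : ∀ {n} (G : Graph n) (S : Subset n) → Dec (Dominating G S)
dominating? G S = all? λ v → (v ∈? S) ⊎-dec any? (λ u → (u ∈? S) ×-dec (adj G u v ≟B true))

allSubsets : ∀ n → List (Subset n)
allSubsets zero = [] ∷ []
allSubsets (suc n) = map (true ∷_) (allSubsets n) ++ map (false ∷_) (allSubsets n)

d : ∀ {n} → Graph n → ℕ → ℕ
d {n} G i = length (filter (λ S → dominating? G S ×-dec (∣ S ∣ Data.Nat.≟ i)) (allSubsets n))

IsDominationNumber : ∀ {n} → Graph n → ℕ → Set
IsDominationNumber {n} G g =
  (Σ (Subset n) λ S → Dominating G S × ∣ S ∣ ≡ g) ×
  (∀ S → Dominating G S → g ≤ ∣ S ∣)

{-# OPTIONS --safe #-}
-- Sending a pair (S, v), with S a dominating set of size i and v ∉ S, to (S ∪ {v}, v) gives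
-- (n − i) d_i ≤ Σ r(S′) over the dominating sets S′ of size i + 1, where r(S′) counts the
-- removable vertices of S′ (those v ∈ S′ with S′ − v still dominating).
-- In a forest 2γ + r(S) ≤ 2|S|. If deleting x ∈ S makes another removable z non-removable, some
-- vertex is dominated by x and z alone among S; so if every removable vertex had two such
-- partners, chaining them (through that vertex when x and z are not adjacent) would give a
-- non-backtracking walk, hence a cycle. Thus some removable x has at most one partner, so
-- r(S) ≤ 2 + r(S − x), and induction on |S| applies.
-- For |S| = i + 1 ≤ (n + 2γ + 1)/3 this yields r(S) ≤ n − i, hence d_i ≤ d_{i+1}.
module Submission where

open import Defs hiding (sym)
open import Data.Bool using (true; false; not; if_then_else_)
open import Data.Bool.Properties using () renaming (_≟_ to _≟ᵇ_)
open import Data.Fin using (Fin; zero; suc)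
open import Data.Fin.Properties using (any?; ¬∀⟶∃¬; injective⇒≤)
  renaming (suc-injective to Fin-suc-injective; _≟_ to _≟ᶠ_)
open import Data.Fin.Subset using (Subset; _∈_; _∉_; _⊆_; _-_; ⁅_⁆; ∁; ∣_∣)
open import Data.Fin.Subset.Properties
  using (_∈?_; x∈p⇒∣p-x∣<∣p∣; ∣∁p∣≡n∸∣p∣; p─⊥≡p; p─q⊆p; x∈p∧x≢y⇒x∈p-y)
open import Data.List using (List; []; _∷_; _++_; map; length; filter; lookup)
open import Data.List.Membership.Propositional using () renaming (_∈_ to _∈ₗ_)
open import Data.List.Membership.Propositional.Properties using (∈-lookup)
import Data.List.Membership.DecPropositional as DecMembership
open import Data.List.Properties using (map-++; map-∘)
open import Data.List.Relation.Unary.All as All using (All; []; _∷_)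
open import Data.List.Relation.Unary.All.Properties using (¬Any⇒All¬)
open import Data.List.Relation.Unary.AllPairs using (AllPairs; []; _∷_)
open import Data.List.Relation.Unary.Any as Any using ()
open import Data.Nat using (ℕ; zero; suc; _+_; _*_; _∸_; _≤_; _<_; _/_; z≤n; s≤s; >-nonZero)
open import Data.Nat.DivMod using (m/n*n≤m)
open import Data.Nat.Induction using (<-wellFounded)
open import Data.Nat.ListAction using (sum)
open import Data.Nat.ListAction.Properties using (sum-++)
open import Data.Nat.Properties
open import Data.Nat.Tactic.RingSolver using (solve-∀)
open import Data.Product using (Σ; ∃; _×_; _,_; proj₁; proj₂)
open import Data.Sum using (_⊎_; inj₁; inj₂; swap)
open import Data.Vec using ([]; _∷_; here; there; updateAt)
open import Function using (_∘_)
open import Induction.WellFounded using (Acc; acc)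
open import Relation.Binary.PropositionalEquality
open import Relation.Nullary using (¬_; Dec; yes; no; does; ¬?; contradiction)
open import Relation.Nullary.Decidable using (_×-dec_; _⊎-dec_; decidable-stable)
open import Algebra.Properties.CommutativeSemigroup +-commutativeSemigroup using () renaming (x∙yz≈y∙xz to +-exchange)
open import Algebra.Properties.Semiring.Sum +-*-semiring
  using (sum-syntax; sum-cong-≗; sum-replicate-zero; ∑-distrib-+)
  renaming (sum to ∑)

-- Indicators and sums

-- Defined through `does`, so that it computes on decisions built with `map′`, such as `suc v ∈? (b ∷ S)`.
𝟙 : ∀ {p} {P : Set p} → Dec P → ℕ
𝟙 P? = if does P? then 1 else 0

𝟙-mono : ∀ {p q} {P : Set p} {Q : Set q} (P? : Dec P) (Q? : Dec Q) → (P → Q) → 𝟙 P? ≤ 𝟙 Q?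
𝟙-mono (yes _) (yes _) _   = ≤-refl
𝟙-mono (yes p) (no ¬q) P⇒Q = contradiction (P⇒Q p) ¬q
𝟙-mono (no _)  _       _   = z≤n

𝟙-⊎ : ∀ {p q r} {P : Set p} {Q : Set q} {R : Set r} (P? : Dec P) (Q? : Dec Q) (R? : Dec R) →
      (P → Q ⊎ R) → 𝟙 P? ≤ 𝟙 Q? + 𝟙 R?
𝟙-⊎ (no _)  _       _       _     = z≤n
𝟙-⊎ (yes _) (yes _) _       _     = s≤s z≤n
𝟙-⊎ (yes _) (no _)  (yes _) _     = s≤s z≤n
𝟙-⊎ (yes p) (no ¬q) (no ¬r) P⇒Q⊎R with P⇒Q⊎R p
... | inj₁ q = contradiction q ¬q
... | inj₂ r = contradiction r ¬r

∑-mono-≤ : ∀ {n} {f g : Fin n → ℕ} → (∀ v → f v ≤ g v) → ∑ f ≤ ∑ g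
∑-mono-≤ {zero}  f≤g = z≤n
∑-mono-≤ {suc n} f≤g = +-mono-≤ (f≤g zero) (∑-mono-≤ (f≤g ∘ suc))

∑𝟙-no : ∀ {n p} {P : Fin n → Set p} (P? : ∀ v → Dec (P v)) → (∀ v → ¬ P v) → ∑[ v < n ] 𝟙 (P? v) ≡ 0
∑𝟙-no {zero}  P? ¬P = refl
∑𝟙-no {suc n} P? ¬P with P? zero
... | yes p = contradiction p (¬P zero)
... | no  _ = ∑𝟙-no (P? ∘ suc) (¬P ∘ suc)

∑𝟙-unique : ∀ {n p} {P : Fin n → Set p} (P? : ∀ v → Dec (P v)) →
            (∀ u v → P u → P v → u ≡ v) → ∑[ v < n ] 𝟙 (P? v) ≤ 1
∑𝟙-unique {zero}  P? unique = z≤n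
∑𝟙-unique {suc n} P? unique with P? zero
... | yes p = ≤-reflexive (cong suc (∑𝟙-no (P? ∘ suc) λ v q → 0≢suc (unique zero (suc v) p q)))
  where
  0≢suc : ∀ {v : Fin n} → zero ≢ suc v
  0≢suc ()
... | no  _ = ∑𝟙-unique (P? ∘ suc) λ u v p q → Fin-suc-injective (unique (suc u) (suc v) p q)

∑𝟙-∉ : ∀ {n} (S : Subset n) → ∑[ v < n ] 𝟙 (¬? (v ∈? S)) ≡ n ∸ ∣ S ∣
∑𝟙-∉ S = trans (count-∁ S) (∣∁p∣≡n∸∣p∣ S)
  where
  count-∁ : ∀ {n} (S : Subset n) → ∑[ v < n ] 𝟙 (¬? (v ∈? S)) ≡ ∣ ∁ S ∣
  count-∁ []            = refl
  count-∁ (true  ∷ S) = count-∁ S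
  count-∁ (false ∷ S) = cong suc (count-∁ S)

sumSubsets : ∀ n → (Subset n → ℕ) → ℕ
sumSubsets zero    f = f []
sumSubsets (suc n) f = sumSubsets n (f ∘ (true ∷_)) + sumSubsets n (f ∘ (false ∷_))

sumSubsets-cong : ∀ n {f g : Subset n → ℕ} → (∀ S → f S ≡ g S) → sumSubsets n f ≡ sumSubsets n g
sumSubsets-cong zero    f≗g = f≗g []
sumSubsets-cong (suc n) f≗g = cong₂ _+_ (sumSubsets-cong n (f≗g ∘ (true ∷_))) (sumSubsets-cong n (f≗g ∘ (false ∷_)))

sumSubsets-mono-≤ : ∀ n {f g : Subset n → ℕ} → (∀ S → f S ≤ g S) → sumSubsets n f ≤ sumSubsets n g
sumSubsets-mono-≤ zero    f≤g = f≤g []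
sumSubsets-mono-≤ (suc n) f≤g =
  +-mono-≤ (sumSubsets-mono-≤ n (f≤g ∘ (true ∷_))) (sumSubsets-mono-≤ n (f≤g ∘ (false ∷_)))

*-distribˡ-sumSubsets : ∀ n c (f : Subset n → ℕ) → c * sumSubsets n f ≡ sumSubsets n (λ S → c * f S)
*-distribˡ-sumSubsets zero    c f = refl
*-distribˡ-sumSubsets (suc n) c f =
  trans (*-distribˡ-+ c _ _) (cong₂ _+_ (*-distribˡ-sumSubsets n c _) (*-distribˡ-sumSubsets n c _))

sumSubsets-∑-comm : ∀ n {m} (f : Subset n → Fin m → ℕ) →
                    sumSubsets n (λ S → ∑[ v < m ] f S v) ≡ ∑[ v < m ] sumSubsets n (λ S → f S v)
sumSubsets-∑-comm zero    f = refl
sumSubsets-∑-comm (suc n) {m} f = begin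
  sumSubsets n (λ S → ∑[ v < m ] f (true ∷ S) v) + sumSubsets n (λ S → ∑[ v < m ] f (false ∷ S) v)
    ≡⟨ cong₂ _+_ (sumSubsets-∑-comm n (f ∘ (true ∷_))) (sumSubsets-∑-comm n (f ∘ (false ∷_))) ⟩
  ∑[ v < m ] sumSubsets n (λ S → f (true ∷ S) v) + ∑[ v < m ] sumSubsets n (λ S → f (false ∷ S) v)
    ≡⟨ ∑-distrib-+ (λ v → sumSubsets n (λ S → f (true ∷ S) v)) (λ v → sumSubsets n (λ S → f (false ∷ S) v)) ⟨
  ∑[ v < m ] sumSubsets (suc n) (λ S → f S v) ∎
  where open ≡-Reasoning

toggle : ∀ {n} → Subset n → Fin n → Subset n
toggle S v = updateAt S v not

sumSubsets-toggle : ∀ n (f : Subset n → ℕ) v → sumSubsets n f ≡ sumSubsets n (λ S → f (toggle S v))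
sumSubsets-toggle (suc n) f zero    = +-comm (sumSubsets n (f ∘ (true ∷_))) _
sumSubsets-toggle (suc n) f (suc v) = cong₂ _+_ (sumSubsets-toggle n _ v) (sumSubsets-toggle n _ v)

length-filter≡sum-𝟙 : ∀ {a p} {A : Set a} {P : A → Set p} (P? : ∀ x → Dec (P x)) (xs : List A) →
                      length (filter P? xs) ≡ sum (map (𝟙 ∘ P?) xs)
length-filter≡sum-𝟙 P? []       = refl
length-filter≡sum-𝟙 P? (x ∷ xs) with does (P? x)
... | true  = cong suc (length-filter≡sum-𝟙 P? xs)
... | false = length-filter≡sum-𝟙 P? xs

sum-map-allSubsets : ∀ n (f : Subset n → ℕ) → sum (map f (allSubsets n)) ≡ sumSubsets n f
sum-map-allSubsets zero    f = +-identityʳ (f [])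
sum-map-allSubsets (suc n) f = begin
  sum (map f (map (true ∷_) Ss ++ map (false ∷_) Ss))
    ≡⟨ cong sum (map-++ f (map (true ∷_) Ss) _) ⟩
  sum (map f (map (true ∷_) Ss) ++ map f (map (false ∷_) Ss))
    ≡⟨ sum-++ (map f (map (true ∷_) Ss)) _ ⟩
  sum (map f (map (true ∷_) Ss)) + sum (map f (map (false ∷_) Ss))
    ≡⟨ cong₂ _+_ (cong sum (map-∘ Ss)) (cong sum (map-∘ Ss)) ⟨
  sum (map (f ∘ (true ∷_)) Ss) + sum (map (f ∘ (false ∷_)) Ss)
    ≡⟨ cong₂ _+_ (sum-map-allSubsets n _) (sum-map-allSubsets n _) ⟩
  sumSubsets (suc n) f ∎
  where
  open ≡-Reasoning
  Ss = allSubsets n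

count-allSubsets : ∀ n {p} {P : Subset n → Set p} (P? : ∀ S → Dec (P S)) →
                   length (filter P? (allSubsets n)) ≡ sumSubsets n (𝟙 ∘ P?)
count-allSubsets n P? = trans (length-filter≡sum-𝟙 P? (allSubsets n)) (sum-map-allSubsets n (𝟙 ∘ P?))

x∉p-x : ∀ {n} (p : Subset n) x → x ∉ p - x
x∉p-x (s ∷ p) zero    ()
x∉p-x (s ∷ p) (suc x) (there x∈p-x) = x∉p-x p x x∈p-x

x∈p⇒suc∣p-x∣≡∣p∣ : ∀ {n} {p : Subset n} {x} → x ∈ p → suc ∣ p - x ∣ ≡ ∣ p ∣
x∈p⇒suc∣p-x∣≡∣p∣ {p = true ∷ p}  here        = cong suc (cong ∣_∣ (p─⊥≡p p))
x∈p⇒suc∣p-x∣≡∣p∣ {p = true ∷ p}  (there x∈p) = cong suc (x∈p⇒suc∣p-x∣≡∣p∣ x∈p)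
x∈p⇒suc∣p-x∣≡∣p∣ {p = false ∷ p} (there x∈p) = x∈p⇒suc∣p-x∣≡∣p∣ x∈p

toggle-∈ : ∀ {n} {p : Subset n} {x} → x ∈ p → toggle p x ≡ p - x
toggle-∈ {p = true ∷ p} here        = cong (false ∷_) (sym (p─⊥≡p p))
toggle-∈ {p = s ∷ p}    (there x∈p) = cong (s ∷_) (toggle-∈ x∈p)

∉-toggle⇒∈ : ∀ {n} (p : Subset n) x → x ∉ toggle p x → x ∈ p
∉-toggle⇒∈ (true  ∷ p) zero    x∉ = here
∉-toggle⇒∈ (false ∷ p) zero    x∉ = contradiction here x∉
∉-toggle⇒∈ (s ∷ p)     (suc x) x∉ = there (∉-toggle⇒∈ p x (x∉ ∘ there))

-- Non-backtracking walks

distinct⇒length≤ : ∀ {n} {xs : List (Fin n)} → AllPairs _≢_ xs → length xs ≤ n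
distinct⇒length≤ distinct = injective⇒≤ (lookup-injective distinct)
  where
  lookup-injective : ∀ {A : Set} {xs : List A} → AllPairs _≢_ xs → ∀ {i j} → lookup xs i ≡ lookup xs j → i ≡ j
  lookup-injective (x≢ ∷ _) {zero}  {zero}  _  = refl
  lookup-injective (x≢ ∷ _) {zero}  {suc j} eq = contradiction eq (All.lookup x≢ (∈-lookup j))
  lookup-injective (x≢ ∷ _) {suc i} {zero}  eq = contradiction (sym eq) (All.lookup x≢ (∈-lookup i))
  lookup-injective (_ ∷ d)  {suc i} {suc j} eq = cong suc (lookup-injective d eq)

module _ {A : Set} {c : A} where

  takeThrough : (xs : List A) → c ∈ₗ xs → List A
  takeThrough (x ∷ xs) (Any.here _)  = x ∷ []
  takeThrough (x ∷ xs) (Any.there m) = x ∷ takeThrough xs m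

  takeThrough-nonempty : ∀ xs (m : c ∈ₗ xs) → 1 ≤ length (takeThrough xs m)
  takeThrough-nonempty (x ∷ xs) (Any.here _)  = s≤s z≤n
  takeThrough-nonempty (x ∷ xs) (Any.there m) = s≤s z≤n

  All-takeThrough : ∀ {P : A → Set} xs (m : c ∈ₗ xs) → All P xs → All P (takeThrough xs m)
  All-takeThrough (x ∷ xs) (Any.here _)  (px ∷ _)   = px ∷ []
  All-takeThrough (x ∷ xs) (Any.there m) (px ∷ pxs) = px ∷ All-takeThrough xs m pxs

  AllPairs-takeThrough : ∀ {R : A → A → Set} xs (m : c ∈ₗ xs) → AllPairs R xs → AllPairs R (takeThrough xs m)
  AllPairs-takeThrough (x ∷ xs) (Any.here _)  (rx ∷ _)   = [] ∷ []
  AllPairs-takeThrough (x ∷ xs) (Any.there m) (rx ∷ rxs) = All-takeThrough xs m rx ∷ AllPairs-takeThrough xs m rxs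

module _ {n} (G : Graph n) where

  adj-sym : ∀ {u v} → Adj G u v → Adj G v u
  adj-sym {u} {v} u~v = trans (Graph.sym G v u) u~v

  adj-irrefl : ∀ {u} → ¬ Adj G u u
  adj-irrefl {u} u~u with () ← trans (sym u~u) (Graph.irrefl G u)

  module _ {c : Fin n} where

    ChainFrom-takeThrough : ∀ {y} xs (m : c ∈ₗ xs) → ChainFrom G y xs → ChainFrom G y (takeThrough xs m)
    ChainFrom-takeThrough (x ∷ xs) (Any.here _)  (y~x , _)     = y~x , _
    ChainFrom-takeThrough (x ∷ xs) (Any.there m) (y~x , chain) = y~x , ChainFrom-takeThrough xs m chain

    lastOf-takeThrough : ∀ y xs (m : c ∈ₗ xs) → lastOf y (takeThrough xs m) ≡ c
    lastOf-takeThrough y (x ∷ xs) (Any.here c≡x) = sym c≡x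
    lastOf-takeThrough y (x ∷ xs) (Any.there m)  = lastOf-takeThrough x xs m

  module _ {St : Set} (cur : St → Fin n) (next : St → St)
           (adjacent : ∀ s → Adj G (cur s) (cur (next s)))
           (non-backtracking : ∀ s → cur (next (next s)) ≢ cur s) where

    open DecMembership (_≟ᶠ_ {n}) using () renaming (_∈?_ to _∈ₗ?_)

    -- The walk so far, most recent vertex first, is  cur (next p) ∷ cur p ∷ rest;
    -- its vertices are distinct, so there are at most n of them and the fuel never runs out.
    extend : ∀ fuel p rest → n ≤ fuel + length rest →
             AllPairs _≢_ (cur (next p) ∷ cur p ∷ rest) → ChainFrom G (cur (next p)) (cur p ∷ rest) → HasCycle G
    extend zero p rest n≤ distinct chain =
      contradiction (≤-trans (n≤1+n _) (≤-trans (distinct⇒length≤ distinct) n≤)) 1+n≰n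
    extend (suc fuel) p rest n≤ distinct chain with cur (next (next p)) ∈ₗ? (cur (next p) ∷ cur p ∷ rest)
    ... | yes (Any.here c≡x) = contradiction (subst (Adj G _) c≡x (adjacent (next p))) adj-irrefl
    ... | yes (Any.there (Any.here c≡y)) = contradiction c≡y (non-backtracking p)
    ... | yes (Any.there (Any.there m)) = close distinct
      where
      x = cur (next p)
      y = cur p
      close : AllPairs _≢_ (x ∷ y ∷ rest) → HasCycle G
      close ((x≢y ∷ x≢rest) ∷ (y≢rest ∷ rest-distinct)) =
        x , (y ∷ takeThrough rest m) , s≤s (takeThrough-nonempty rest m) ,
        ((x≢y ∷ All-takeThrough rest m x≢rest) ∷
          (All-takeThrough rest m y≢rest ∷ AllPairs-takeThrough rest m rest-distinct)) ,
        (proj₁ chain , ChainFrom-takeThrough rest m (proj₂ chain)) ,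
        subst (λ z → Adj G z x) (sym (lastOf-takeThrough y rest m)) (adj-sym (adjacent (next p)))
    ... | no c∉ = extend fuel (next p) (cur p ∷ rest) (subst (n ≤_) (sym (+-suc fuel (length rest))) n≤)
                    (¬Any⇒All¬ _ c∉ ∷ distinct) (adj-sym (adjacent (next p)) , chain)

    nonBacktracking⇒cycle : St → HasCycle G
    nonBacktracking⇒cycle s =
      extend n s [] (≤-reflexive (sym (+-identityʳ n)))
        (((λ eq → adj-irrefl (subst (Adj G (cur s)) eq (adjacent s))) ∷ []) ∷ ([] ∷ []))
        (adj-sym (adjacent s) , _)

  -- Removable vertices of dominating sets

  adj? : ∀ u v → Dec (Adj G u v)
  adj? u v = adj G u v ≟ᵇ true

  Dominates : Fin n → Fin n → Set
  Dominates u w = u ≡ w ⊎ Adj G u w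

  dominator : ∀ {S} → Dominating G S → ∀ w → ∃ λ u → u ∈ S × Dominates u w
  dominator dom w with dom w
  ... | inj₁ w∈S              = w , w∈S , inj₁ refl
  ... | inj₂ (u , u∈S , u~w) = u , u∈S , inj₂ u~w

  undominated : ∀ {S} → ¬ Dominating G S → ∃ λ w → ∀ u → u ∈ S → ¬ Dominates u w
  undominated {S} ¬dom with ¬∀⟶∃¬ n _ (λ v → (v ∈? S) ⊎-dec any? (λ u → (u ∈? S) ×-dec adj? u v)) ¬dom
  ... | w , ¬dom-w = w , λ { u u∈S (inj₁ refl) → ¬dom-w (inj₁ u∈S)
                           ; u u∈S (inj₂ u~w) → ¬dom-w (inj₂ (u , u∈S , u~w)) }

  Dominating-⊆ : ∀ {S S′} → S ⊆ S′ → Dominating G S → Dominating G S′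
  Dominating-⊆ S⊆S′ dom v with dom v
  ... | inj₁ v∈S              = inj₁ (S⊆S′ v∈S)
  ... | inj₂ (u , u∈S , u~v) = inj₂ (u , S⊆S′ u∈S , u~v)

  Removable : Subset n → Fin n → Set
  Removable S v = v ∈ S × Dominating G (S - v)

  removable? : ∀ S v → Dec (Removable S v)
  removable? S v = (v ∈? S) ×-dec dominating? G (S - v)

  removables : Subset n → ℕ
  removables S = ∑[ v < n ] 𝟙 (removable? S v)

  record Conflicting (S : Subset n) (x z : Fin n) : Set where
    field
      distinct   : x ≢ z
      witness    : Fin n
      dominates₁ : Dominates x witness
      dominates₂ : Dominates z witness
      private-to : ∀ u → u ∈ S → Dominates u witness → u ≡ x ⊎ u ≡ z

    module _ (x≁z : ¬ Adj G x z) where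

      adj₁ : Adj G x witness
      adj₁ with dominates₁
      ... | inj₂ x~w = x~w
      ... | inj₁ x≡w with subst (Dominates z) (sym x≡w) dominates₂
      ...   | inj₁ z≡x = contradiction (sym z≡x) distinct
      ...   | inj₂ z~x = contradiction (adj-sym z~x) x≁z

      adj₂ : Adj G z witness
      adj₂ with dominates₂
      ... | inj₂ z~w = z~w
      ... | inj₁ z≡w with subst (Dominates x) (sym z≡w) dominates₁
      ...   | inj₁ x≡z = contradiction x≡z distinct
      ...   | inj₂ x~z = contradiction x~z x≁z

      witness∉ : witness ∉ S
      witness∉ w∈S with private-to witness w∈S (inj₁ refl)
      ... | inj₁ w≡x = adj-irrefl (subst (λ u → Adj G u witness) (sym w≡x) adj₁)
      ... | inj₂ w≡z = adj-irrefl (subst (λ u → Adj G u witness) (sym w≡z) adj₂)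

  open Conflicting

  Lost : Subset n → Fin n → Fin n → Set
  Lost S x z = Removable S z × ¬ Removable (S - x) z

  lost? : ∀ S x z → Dec (Lost S x z)
  lost? S x z = removable? S z ×-dec ¬? (removable? (S - x) z)

  lost⇒conflicting : ∀ {S x z} → Dominating G (S - x) → z ≢ x → Lost S x z → Conflicting S x z
  lost⇒conflicting {S} {x} {z} dom-S-x z≢x ((z∈S , dom-S-z) , ¬removable) = record
    { distinct   = z≢x ∘ sym
    ; witness    = w
    ; dominates₁ = the-other dom-S-z only
    ; dominates₂ = the-other dom-S-x (λ u u∈S u↝w → swap (only u u∈S u↝w))
    ; private-to = only
    }
    where
    undominated-w = undominated (¬removable ∘ (x∈p∧x≢y⇒x∈p-y z∈S z≢x ,_))
    w = proj₁ undominated-w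

    only : ∀ u → u ∈ S → Dominates u w → u ≡ x ⊎ u ≡ z
    only u u∈S u↝w with u ≟ᶠ x | u ≟ᶠ z
    ... | yes u≡x | _       = inj₁ u≡x
    ... | no _    | yes u≡z = inj₂ u≡z
    ... | no u≢x  | no u≢z  =
      contradiction u↝w (proj₂ undominated-w u (x∈p∧x≢y⇒x∈p-y (x∈p∧x≢y⇒x∈p-y u∈S u≢x) u≢z))

    the-other : ∀ {a b} → Dominating G (S - b) → (∀ u → u ∈ S → Dominates u w → u ≡ a ⊎ u ≡ b) → Dominates a w
    the-other {b = b} dom only′ with dominator dom w
    ... | u , u∈S-b , u↝w with only′ u (p─q⊆p S ⁅ b ⁆ u∈S-b) u↝w
    ...   | inj₁ refl = u↝w
    ...   | inj₂ refl = contradiction u∈S-b (x∉p-x S u)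

  AtMostOneOther : Subset n → Fin n → Set
  AtMostOneOther S x = ∀ z₁ z₂ → z₁ ≢ x → z₂ ≢ x → Lost S x z₁ → Lost S x z₂ → z₁ ≡ z₂

  TwoOthers : Subset n → Fin n → Set
  TwoOthers S x = ∃ λ z₁ → ∃ λ z₂ → z₁ ≢ z₂ × z₁ ≢ x × z₂ ≢ x × Lost S x z₁ × Lost S x z₂

  twoOthers? : ∀ S x → Dec (TwoOthers S x)
  twoOthers? S x = any? λ z₁ → any? λ z₂ →
    ¬? (z₁ ≟ᶠ z₂) ×-dec ¬? (z₁ ≟ᶠ x) ×-dec ¬? (z₂ ≟ᶠ x) ×-dec lost? S x z₁ ×-dec lost? S x z₂

  ¬twoOthers⇒atMostOneOther : ∀ {S x} → ¬ TwoOthers S x → AtMostOneOther S x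
  ¬twoOthers⇒atMostOneOther ¬two z₁ z₂ z₁≢x z₂≢x lost₁ lost₂ =
    decidable-stable (z₁ ≟ᶠ z₂) λ z₁≢z₂ → ¬two (z₁ , z₂ , z₁≢z₂ , z₁≢x , z₂≢x , lost₁ , lost₂)

  module ConflictWalk {S : Subset n} (two : ∀ x → Removable S x → TwoOthers S x) where

    record Link : Set where
      field
        src tgt       : Fin n
        src-removable : Removable S src
        tgt≢src       : tgt ≢ src
        tgt-lost      : Lost S src tgt

      conflict : Conflicting S src tgt
      conflict = lost⇒conflicting (proj₂ src-removable) tgt≢src tgt-lost

      src∈S : src ∈ S
      src∈S = proj₁ src-removable

      tgt∈S : tgt ∈ S
      tgt∈S = proj₁ (proj₁ tgt-lost)

    open Link

    onward : (l : Link) → ∃ λ c → c ≢ src l × c ≢ tgt l × Lost S (tgt l) c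
    onward l with two (tgt l) (proj₁ (tgt-lost l))
    ... | z₁ , z₂ , z₁≢z₂ , z₁≢x , z₂≢x , lost₁ , lost₂ with z₁ ≟ᶠ src l
    ...   | yes z₁≡src = z₂ , (λ z₂≡src → z₁≢z₂ (trans z₁≡src (sym z₂≡src))) , z₂≢x , lost₂
    ...   | no  z₁≢src = z₁ , z₁≢src , z₁≢x , lost₁

    nextLink : Link → Link
    nextLink l = record
      { src           = tgt l
      ; tgt           = proj₁ (onward l)
      ; src-removable = proj₁ (tgt-lost l)
      ; tgt≢src       = proj₁ (proj₂ (proj₂ (onward l)))
      ; tgt-lost      = proj₂ (proj₂ (proj₂ (onward l)))
      }

    nextLink-≢ : ∀ l → tgt (nextLink l) ≢ src l
    nextLink-≢ l = proj₁ (proj₂ (onward l))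

    data Phase (l : Link) : Set where
      atWitness : ¬ Adj G (src l) (tgt l) → Phase l
      atTarget  : Phase l

    State : Set
    State = Σ Link Phase

    position : State → Fin n
    position (l , atWitness _) = witness (conflict l)
    position (l , atTarget)    = tgt l

    enter : (l : Link) → Dec (Adj G (src l) (tgt l)) → State
    enter l (yes _)       = l , atTarget
    enter l (no  src≁tgt) = l , atWitness src≁tgt

    advance : State → State
    advance (l , atWitness _) = l , atTarget
    advance (l , atTarget)    = enter (nextLink l) (adj? (tgt l) (tgt (nextLink l)))

    enter-adjacent : ∀ l d → Adj G (src l) (position (enter l d))
    enter-adjacent l (yes src~tgt) = src~tgt
    enter-adjacent l (no  src≁tgt) = adj₁ (conflict l) src≁tgt

    advance-adjacent : ∀ s → Adj G (position s) (position (advance s))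
    advance-adjacent (l , atWitness src≁tgt) = adj-sym (adj₂ (conflict l) src≁tgt)
    advance-adjacent (l , atTarget)          = enter-adjacent (nextLink l) (adj? _ _)

    enter-position : ∀ l d → position (enter l d) ≡ tgt l ⊎ position (enter l d) ∉ S
    enter-position l (yes _)       = inj₁ refl
    enter-position l (no  src≁tgt) = inj₂ (witness∉ (conflict l) src≁tgt)

    enter-≢-witness : ∀ l (src≁tgt : ¬ Adj G (src l) (tgt l)) d →
                      position (enter (nextLink l) d) ≢ witness (conflict l)
    enter-≢-witness l src≁tgt (yes _) p≡w =
      witness∉ (conflict l) src≁tgt (subst (_∈ S) p≡w (tgt∈S (nextLink l)))
    enter-≢-witness l src≁tgt (no _) p≡w
      with private-to (conflict l) (tgt (nextLink l)) (tgt∈S (nextLink l))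
             (subst (Dominates (tgt (nextLink l))) p≡w (dominates₂ (conflict (nextLink l))))
    ... | inj₁ tgt′≡src = nextLink-≢ l tgt′≡src
    ... | inj₂ tgt′≡tgt = tgt≢src (nextLink l) tgt′≡tgt

    advance-enter-≢-src : ∀ l d → position (advance (enter l d)) ≢ src l
    advance-enter-≢-src l (yes _) p≡src with enter-position (nextLink l) (adj? _ _)
    ... | inj₁ p≡tgt′ = nextLink-≢ l (trans (sym p≡tgt′) p≡src)
    ... | inj₂ p∉S    = p∉S (subst (_∈ S) (sym p≡src) (src∈S l))
    advance-enter-≢-src l (no _) = tgt≢src l

    advance²-≢ : ∀ s → position (advance (advance s)) ≢ position s
    advance²-≢ (l , atWitness src≁tgt) = enter-≢-witness l src≁tgt (adj? _ _)
    advance²-≢ (l , atTarget)          = advance-enter-≢-src (nextLink l) (adj? _ _)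

    removable⇒cycle : ∀ {x₀} → Removable S x₀ → HasCycle G
    removable⇒cycle {x₀} r₀ with two x₀ r₀
    ... | z , _ , _ , z≢x₀ , _ , lost , _ =
      nonBacktracking⇒cycle position advance advance-adjacent advance²-≢ (enter l₀ (adj? x₀ z))
      where
      l₀ : Link
      l₀ = record { src = x₀ ; tgt = z ; src-removable = r₀ ; tgt≢src = z≢x₀ ; tgt-lost = lost }

  acyclic⇒removable-with-one-other : ¬ HasCycle G → ∀ {S x₀} → Removable S x₀ →
                                     ∃ λ x → Removable S x × AtMostOneOther S x
  acyclic⇒removable-with-one-other acyclic {S} r₀ with any? (λ x → removable? S x ×-dec ¬? (twoOthers? S x))
  ... | yes (x , rx , ¬two) = x , rx , ¬twoOthers⇒atMostOneOther ¬two
  ... | no  none = contradiction (ConflictWalk.removable⇒cycle two r₀) acyclic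
    where
    two : ∀ x → Removable S x → TwoOthers S x
    two x rx = decidable-stable (twoOthers? S x) λ ¬two → none (x , rx , ¬two)

  removables-≤-lost : ∀ S x → removables S ≤ ∑[ v < n ] 𝟙 (lost? S x v) + removables (S - x)
  removables-≤-lost S x = begin
    removables S
      ≤⟨ ∑-mono-≤ (λ v → 𝟙-⊎ (removable? S v) (lost? S x v) (removable? (S - x) v) (lost-or-removable v)) ⟩
    ∑[ v < n ] (𝟙 (lost? S x v) + 𝟙 (removable? (S - x) v))
      ≡⟨ ∑-distrib-+ (λ v → 𝟙 (lost? S x v)) (λ v → 𝟙 (removable? (S - x) v)) ⟩
    ∑[ v < n ] 𝟙 (lost? S x v) + removables (S - x) ∎
    where
    open ≤-Reasoning
    lost-or-removable : ∀ v → Removable S v → Lost S x v ⊎ Removable (S - x) v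
    lost-or-removable v r with removable? (S - x) v
    ... | yes r′ = inj₂ r′
    ... | no ¬r′ = inj₁ (r , ¬r′)

  lost-count≤2 : ∀ {S x} → AtMostOneOther S x → ∑[ v < n ] 𝟙 (lost? S x v) ≤ 2
  lost-count≤2 {S} {x} atMostOne = begin
    ∑[ v < n ] 𝟙 (lost? S x v)
      ≤⟨ ∑-mono-≤ (λ v → 𝟙-⊎ (lost? S x v) (v ≟ᶠ x) (other? v) (self-or-other v)) ⟩
    ∑[ v < n ] (𝟙 (v ≟ᶠ x) + 𝟙 (other? v))
      ≡⟨ ∑-distrib-+ (λ v → 𝟙 (v ≟ᶠ x)) (λ v → 𝟙 (other? v)) ⟩
    ∑[ v < n ] 𝟙 (v ≟ᶠ x) + ∑[ v < n ] 𝟙 (other? v)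
      ≤⟨ +-mono-≤ (∑𝟙-unique (_≟ᶠ x) λ _ _ u≡x v≡x → trans u≡x (sym v≡x))
                  (∑𝟙-unique other? λ u v (u≢x , lost-u) (v≢x , lost-v) → atMostOne u v u≢x v≢x lost-u lost-v) ⟩
    2 ∎
    where
    open ≤-Reasoning
    other? : ∀ v → Dec (v ≢ x × Lost S x v)
    other? v = ¬? (v ≟ᶠ x) ×-dec lost? S x v
    self-or-other : ∀ v → Lost S x v → v ≡ x ⊎ (v ≢ x × Lost S x v)
    self-or-other v lost with v ≟ᶠ x
    ... | yes v≡x = inj₁ v≡x
    ... | no  v≢x = inj₂ (v≢x , lost)

  removables-≤-2+ : ∀ {S x} → AtMostOneOther S x → removables S ≤ 2 + removables (S - x)
  removables-≤-2+ {S} {x} atMostOne = ≤-trans (removables-≤-lost S x) (+-monoˡ-≤ _ (lost-count≤2 atMostOne))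

  acyclic⇒2γ+removables≤2∣S∣ : ¬ HasCycle G → ∀ {g} → (∀ D → Dominating G D → g ≤ ∣ D ∣) →
                               ∀ {S} → Dominating G S → 2 * g + removables S ≤ 2 * ∣ S ∣
  acyclic⇒2γ+removables≤2∣S∣ acyclic {g} γ≤ {S} dom = go S (<-wellFounded ∣ S ∣) dom
    where
    open ≤-Reasoning
    go : ∀ S → Acc _<_ ∣ S ∣ → Dominating G S → 2 * g + removables S ≤ 2 * ∣ S ∣
    go S _ dom with any? (removable? S)
    ... | no none = begin
      2 * g + removables S ≡⟨ cong (2 * g +_) (∑𝟙-no (removable? S) λ v r → none (v , r)) ⟩
      2 * g + 0            ≡⟨ +-identityʳ (2 * g) ⟩
      2 * g                ≤⟨ *-monoʳ-≤ 2 (γ≤ S dom) ⟩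
      2 * ∣ S ∣            ∎
    go S (acc smaller) dom | yes (_ , r₀) with acyclic⇒removable-with-one-other acyclic r₀
    ... | x , (x∈S , dom-S-x) , atMostOne = begin
      2 * g + removables S              ≤⟨ +-monoʳ-≤ (2 * g) (removables-≤-2+ atMostOne) ⟩
      2 * g + (2 + removables (S - x))  ≡⟨ +-exchange (2 * g) 2 _ ⟩
      2 + (2 * g + removables (S - x))  ≤⟨ +-monoʳ-≤ 2 (go (S - x) (smaller (x∈p⇒∣p-x∣<∣p∣ x∈S)) dom-S-x) ⟩
      2 + 2 * ∣ S - x ∣                 ≡⟨ *-distribˡ-+ 2 1 ∣ S - x ∣ ⟨
      2 * suc ∣ S - x ∣                 ≡⟨ cong (2 *_) (x∈p⇒suc∣p-x∣≡∣p∣ x∈S) ⟩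
      2 * ∣ S ∣                         ∎

  -- Counting dominating sets by size

  dominatingOfSize? : ∀ i S → Dec (Dominating G S × ∣ S ∣ ≡ i)
  dominatingOfSize? i S = dominating? G S ×-dec (∣ S ∣ ≟ i)

  d≡sumSubsets : ∀ i → d G i ≡ sumSubsets n (𝟙 ∘ dominatingOfSize? i)
  d≡sumSubsets i = count-allSubsets n (dominatingOfSize? i)

  [n∸i]*𝟙≡∑𝟙∉ : ∀ {i} S (A? : Dec (Dominating G S × ∣ S ∣ ≡ i)) →
                   (n ∸ i) * 𝟙 A? ≡ ∑[ v < n ] 𝟙 (A? ×-dec ¬? (v ∈? S))
  [n∸i]*𝟙≡∑𝟙∉ {i} S (yes (_ , refl)) = trans (*-identityʳ _) (sym (∑𝟙-∉ S))
  [n∸i]*𝟙≡∑𝟙∉ {i} S (no  _)          = trans (*-zeroʳ (n ∸ i)) (sym (sum-replicate-zero n))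

  toggle-∉⇒removable : ∀ {i} S v → (Dominating G (toggle S v) × ∣ toggle S v ∣ ≡ i) × v ∉ toggle S v →
                       (Dominating G S × ∣ S ∣ ≡ suc i) × Removable S v
  toggle-∉⇒removable S v ((dom , size) , v∉) =
    (Dominating-⊆ (p─q⊆p S ⁅ v ⁆) dom-S-v , trans (sym (x∈p⇒suc∣p-x∣≡∣p∣ v∈S)) (cong suc size-S-v)) ,
    (v∈S , dom-S-v)
    where
    v∈S = ∉-toggle⇒∈ S v v∉
    dom-S-v = subst (Dominating G) (toggle-∈ v∈S) dom
    size-S-v = subst (λ T → ∣ T ∣ ≡ _) (toggle-∈ v∈S) size

  double-count : ∀ i → (n ∸ i) * d G i ≤
                       sumSubsets n (λ S → ∑[ v < n ] 𝟙 (dominatingOfSize? (suc i) S ×-dec removable? S v))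
  double-count i = begin
    (n ∸ i) * d G i
      ≡⟨ cong ((n ∸ i) *_) (d≡sumSubsets i) ⟩
    (n ∸ i) * sumSubsets n (𝟙 ∘ A i)
      ≡⟨ *-distribˡ-sumSubsets n (n ∸ i) _ ⟩
    sumSubsets n (λ S → (n ∸ i) * 𝟙 (A i S))
      ≡⟨ sumSubsets-cong n (λ S → [n∸i]*𝟙≡∑𝟙∉ S (A i S)) ⟩
    sumSubsets n (λ S → ∑[ v < n ] 𝟙 (A i S ×-dec ¬? (v ∈? S)))
      ≡⟨ sumSubsets-∑-comm n (λ S v → 𝟙 (A i S ×-dec ¬? (v ∈? S))) ⟩
    ∑[ v < n ] sumSubsets n (λ S → 𝟙 (A i S ×-dec ¬? (v ∈? S)))
      ≡⟨ sum-cong-≗ (λ v → sumSubsets-toggle n (λ S → 𝟙 (A i S ×-dec ¬? (v ∈? S))) v) ⟩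
    ∑[ v < n ] sumSubsets n (λ S → 𝟙 (A i (toggle S v) ×-dec ¬? (v ∈? toggle S v)))
      ≤⟨ ∑-mono-≤ (λ v → sumSubsets-mono-≤ n λ S →
           𝟙-mono (A i (toggle S v) ×-dec ¬? (v ∈? toggle S v)) (A (suc i) S ×-dec removable? S v)
                  (toggle-∉⇒removable S v)) ⟩
    ∑[ v < n ] sumSubsets n (λ S → 𝟙 (A (suc i) S ×-dec removable? S v))
      ≡⟨ sumSubsets-∑-comm n (λ S v → 𝟙 (A (suc i) S ×-dec removable? S v)) ⟨
    sumSubsets n (λ S → ∑[ v < n ] 𝟙 (A (suc i) S ×-dec removable? S v)) ∎
    where
    open ≤-Reasoning
    A = dominatingOfSize?

  d≤d-suc : ∀ {i} → i < n → (∀ S → Dominating G S → ∣ S ∣ ≡ suc i → removables S ≤ n ∸ i) →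
            d G i ≤ d G (suc i)
  d≤d-suc {i} i<n removables≤ = *-cancelˡ-≤ (n ∸ i) {{>-nonZero (m<n⇒0<n∸m i<n)}} (begin
    (n ∸ i) * d G i
      ≤⟨ double-count i ⟩
    sumSubsets n (λ S → ∑[ v < n ] 𝟙 (A (suc i) S ×-dec removable? S v))
      ≤⟨ sumSubsets-mono-≤ n (λ S → ∑𝟙removable≤[n∸i]*𝟙 S (A (suc i) S)) ⟩
    sumSubsets n (λ S → (n ∸ i) * 𝟙 (A (suc i) S))
      ≡⟨ *-distribˡ-sumSubsets n (n ∸ i) _ ⟨
    (n ∸ i) * sumSubsets n (𝟙 ∘ A (suc i))
      ≡⟨ cong ((n ∸ i) *_) (d≡sumSubsets (suc i)) ⟨
    (n ∸ i) * d G (suc i) ∎)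
    where
    open ≤-Reasoning
    A = dominatingOfSize?
    ∑𝟙removable≤[n∸i]*𝟙 : ∀ S (A? : Dec (Dominating G S × ∣ S ∣ ≡ suc i)) →
                          ∑[ v < n ] 𝟙 (A? ×-dec removable? S v) ≤ (n ∸ i) * 𝟙 A?
    ∑𝟙removable≤[n∸i]*𝟙 S (yes (dom , size)) =
      subst (removables S ≤_) (sym (*-identityʳ (n ∸ i))) (removables≤ S dom size)
    ∑𝟙removable≤[n∸i]*𝟙 S (no _) =
      ≤-reflexive (trans (sum-replicate-zero n) (sym (*-zeroʳ (n ∸ i))))

2g+r≤2[1+i]⇒r+i≤n : ∀ {g i r n} → 2 * g + r ≤ 2 * suc i → suc i * 3 ≤ n + 2 * g + 1 → r + i ≤ n
2g+r≤2[1+i]⇒r+i≤n {g} {i} {r} {n} 2g+r≤ 3[i+1]≤ = +-cancelʳ-≤ (2 * g + 2 * suc i + 1) (r + i) n (begin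
  r + i + (2 * g + 2 * suc i + 1)  ≡⟨ lhs g i r ⟩
  (2 * g + r) + suc i * 3          ≤⟨ +-mono-≤ 2g+r≤ 3[i+1]≤ ⟩
  2 * suc i + (n + 2 * g + 1)      ≡⟨ rhs g i n ⟩
  n + (2 * g + 2 * suc i + 1)      ∎)
  where
  open ≤-Reasoning
  lhs : ∀ g i r → r + i + (2 * g + 2 * suc i + 1) ≡ (2 * g + r) + suc i * 3
  lhs = solve-∀
  rhs : ∀ g i n → 2 * suc i + (n + 2 * g + 1) ≡ n + (2 * g + 2 * suc i + 1)
  rhs = solve-∀

g≤i⇒i<n : ∀ {g i n} → g ≤ i → suc i * 3 ≤ n + 2 * g + 1 → i < n
g≤i⇒i<n {g} {i} {n} g≤i 3[i+1]≤ = +-cancelʳ-≤ (2 * i + 2) (suc i) n (begin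
  suc i + (2 * i + 2)  ≡⟨ lhs i ⟩
  suc i * 3            ≤⟨ 3[i+1]≤ ⟩
  n + 2 * g + 1        ≤⟨ +-monoˡ-≤ 1 (+-monoʳ-≤ n (*-monoʳ-≤ 2 g≤i)) ⟩
  n + 2 * i + 1        ≤⟨ n≤1+n _ ⟩
  suc (n + 2 * i + 1)  ≡⟨ rhs i n ⟩
  n + (2 * i + 2)      ∎)
  where
  open ≤-Reasoning
  lhs : ∀ i → suc i + (2 * i + 2) ≡ suc i * 3
  lhs = solve-∀
  rhs : ∀ i n → suc (n + 2 * i + 1) ≡ n + (2 * i + 2)
  rhs = solve-∀

theorem6 : ∀ (n : ℕ) (T : Graph n) → IsTree T →
    ∀ (g : ℕ) → IsDominationNumber T g →
    ∀ (i : ℕ) → g ≤ i → suc i ≤ (n + 2 * g + 1) / 3 →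
    d T i ≤ d T (suc i)
theorem6 n T (_ , _ , acyclic) g (_ , γ≤) i g≤i i+1≤ =
  d≤d-suc T (g≤i⇒i<n g≤i 3[i+1]≤) removables≤
  where
  3[i+1]≤ : suc i * 3 ≤ n + 2 * g + 1
  3[i+1]≤ = ≤-trans (*-monoˡ-≤ 3 i+1≤) (m/n*n≤m (n + 2 * g + 1) 3)
  removables≤ : ∀ S → Dominating T S → ∣ S ∣ ≡ suc i → removables T S ≤ n ∸ i
  removables≤ S dom size = m+n≤o⇒m≤o∸n _ (2g+r≤2[1+i]⇒r+i≤n {g} 2γ+removables≤ 3[i+1]≤)
    where
    2γ+removables≤ : 2 * g + removables T S ≤ 2 * suc i
    2γ+removables≤ =
      subst (λ k → 2 * g + removables T S ≤ 2 * k) size (acyclic⇒2γ+removables≤2∣S∣ T acyclic γ≤ dom)
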